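{- The canonical embedding $\Delta_+^{\mathrm{op}}\hookrightarrow\widehat\Delta_+^{\mathrm{op}}$, $[m]\mapsto [m]_0$, has a retraction $R:\widehat\Delta_+^{\mathrm{op}}\to\Delta_+^{\mathrm{op}}$ with $R([m]_j)=[m]$, and for every object $[m]_j$ of $\widehat\Delta_+^{\mathrm{op}}$ the functor induced by $R$ on co-slice categories, \[ [m]_j/\widehat\Delta_+^{\mathrm{op}} \to [m]/\Delta_+^{\mathrm{op}}, \] is an isomorphism of categories.
   Context: $\Delta_+$ is the category of finite ordinals $[k]=\{0,\dots,k\}$, $k\ge0$, with strictly increasing maps. $\widehat\Delta_+$ is the category with an object $[k]_i$ for every $k\ge0$ and every $i\in\{0,\dots,k+1\}$, and with $\widehat\Delta_+([k]_i,[m]_j)$ the set of strictly increasing maps $f:[k]\to[m]$ satisfying: if $i<j$, then $f(x)=x$ for all $x<i$ and $f(x)>x$ for all $x\ge i$; if $i=j$, then $f(x)=x$ for all $x<i$; if $i>j$, no maps. Composition is composition of maps. The embedding and $R$ act on morphisms as the identity on underlying maps. -}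

module Defs where

open import Data.Nat as ℕ using (ℕ; zero; suc)
open import Data.Fin using (Fin; toℕ; _<_)
open import Data.Fin as F using ()
open import Data.Product using (Σ; Σ-syntax; ∃; _×_; _,_; proj₁; proj₂)
open import Data.Sum using (_⊎_)
open import Function using (_∘_)
open import Relation.Binary.PropositionalEquality using (_≡_; refl; _≗_)

-- Δ₊ : objects [k] = {0,…,k} (k : ℕ), morphisms strictly increasing maps.

Map : ℕ → ℕ → Set
Map k m = Fin (suc k) → Fin (suc m)

StrictInc : ∀ {k m} → Map k m → Set
StrictInc f = ∀ x y → x < y → f x < f y

HomΔ : ℕ → ℕ → Set
HomΔ k m = Σ (Map k m) StrictInc

record Objˆ : Set where
  constructor _⟨_⟩
  field
    dim : ℕ
    idx : Fin (suc (suc dim))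
open Objˆ public

FixBelow : ∀ {k m} → ℕ → Map k m → Set
FixBelow i f = ∀ x → toℕ x ℕ.< i → toℕ (f x) ≡ toℕ x

MovesFrom : ∀ {k m} → ℕ → Map k m → Set
MovesFrom i f = ∀ x → i ℕ.≤ toℕ x → toℕ x ℕ.< toℕ (f x)

-- The extra condition on a map [k]_i → [m]_j:
--   i < j : fixes everything below i and moves everything ≥ i upward;
--   i = j : fixes everything below i;
--   i > j : impossible (no maps).
Condˆ : ∀ {k m} → ℕ → ℕ → Map k m → Set
Condˆ i j f = (i ℕ.< j × FixBelow i f × MovesFrom i f) ⊎ (i ≡ j × FixBelow i f)

Homˆ : Objˆ → Objˆ → Set
Homˆ (k ⟨ i ⟩) (m ⟨ j ⟩) = Σ (Map k m) λ f → StrictInc f × Condˆ (toℕ i) (toℕ j) f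

ι₀ : ℕ → Objˆ
ι₀ m = m ⟨ F.zero ⟩

R₀ : Objˆ → ℕ
R₀ X = dim X

R₁ : ∀ {X Y} → Homˆ X Y → HomΔ (dim X) (dim Y)
R₁ (f , s , _) = f , s

-- An object of  [m]_j / Δ̂₊^op  is an arrow [m]_j → X in Δ̂₊^op, i.e. an arrow
-- u : X → [m]_j in Δ̂₊.  A morphism (X,u) → (Y,v) is an arrow h : X → Y in
-- Δ̂₊^op (i.e. h : Y → X in Δ̂₊) with h ∘^op u = v, i.e. u ∘ h = v in Δ̂₊.

CoSliceˆObj : Objˆ → Set
CoSliceˆObj A = Σ Objˆ λ X → Homˆ X A

CoSliceˆHom : ∀ {A} → CoSliceˆObj A → CoSliceˆObj A → Set
CoSliceˆHom (X , u) (Y , v) = Σ (Homˆ Y X) λ h → (proj₁ u ∘ proj₁ h) ≗ proj₁ v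

CoSliceΔObj : ℕ → Set
CoSliceΔObj m = Σ ℕ λ k → HomΔ k m

CoSliceΔHom : ∀ {m} → CoSliceΔObj m → CoSliceΔObj m → Set
CoSliceΔHom (k , u) (l , v) = Σ (HomΔ l k) λ h → (proj₁ u ∘ proj₁ h) ≗ proj₁ v

_≈ˆo_ : ∀ {A} → CoSliceˆObj A → CoSliceˆObj A → Set
((k ⟨ i ⟩) , u) ≈ˆo ((l ⟨ i' ⟩) , v) =
  Σ (k ≡ l) λ { refl → (i ≡ i') × (proj₁ u ≗ proj₁ v) }

_≈Δo_ : ∀ {m} → CoSliceΔObj m → CoSliceΔObj m → Set
(k , u) ≈Δo (l , v) = Σ (k ≡ l) λ { refl → proj₁ u ≗ proj₁ v }

_≈ˆh_ : ∀ {A} {P Q : CoSliceˆObj A} → CoSliceˆHom P Q → CoSliceˆHom P Q → Set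
h ≈ˆh h' = proj₁ (proj₁ h) ≗ proj₁ (proj₁ h')

_≈Δh_ : ∀ {m} {P Q : CoSliceΔObj m} → CoSliceΔHom P Q → CoSliceΔHom P Q → Set
h ≈Δh h' = proj₁ (proj₁ h) ≗ proj₁ (proj₁ h')

R/₀ : ∀ {A} → CoSliceˆObj A → CoSliceΔObj (R₀ A)
R/₀ (X , u) = R₀ X , R₁ u

R/₁ : ∀ {A} {P Q : CoSliceˆObj A} → CoSliceˆHom P Q → CoSliceΔHom (R/₀ P) (R/₀ Q)
R/₁ (h , eq) = R₁ h , eq

-- Isomorphism of categories: bijective on objects and on every hom-set
-- (with respect to the equalities above).
IsIsoR/ : Objˆ → Set
IsIsoR/ A =
  ((Q : CoSliceΔObj (R₀ A)) → Σ (CoSliceˆObj A) λ P → R/₀ P ≈Δo Q)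
  × ((P P' : CoSliceˆObj A) → R/₀ P ≈Δo R/₀ P' → P ≈ˆo P')
  × ((P Q : CoSliceˆObj A) (g : CoSliceΔHom (R/₀ P) (R/₀ Q)) →
       Σ (CoSliceˆHom P Q) λ h → _≈Δh_ {P = R/₀ P} {Q = R/₀ Q} (R/₁ {P = P} {Q = Q} h) g)
  × ((P Q : CoSliceˆObj A) (h h' : CoSliceˆHom P Q) → _≈Δh_ {P = R/₀ P} {Q = R/₀ Q} (R/₁ {P = P} {Q = Q} h) (R/₁ {P = P} {Q = Q} h') →
       _≈ˆh_ {P = P} {Q = Q} h h')

module Submission where

-- For a strictly increasing map f : [k] → [m] the displacement
-- x ↦ f(x) − x is non-negative and non-decreasing, so f fixes an initial
-- segment {0,…,p−1} and moves every x ≥ p.  We call this p ∈ {0,…,k+1} the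
-- threshold of f; it exists (take the smallest moved point, if any) and is
-- unique.  The condition Condˆ i j f on a map [k]_i → [m]_j then says
-- exactly that i = p ⊓ j: the index of the source is determined by the
-- underlying map and the target.  This gives bijectivity of R/ on objects.
-- For fullness, a commuting triangle u ∘ g ≗ v has thresholds related by
-- p_v = p_g ⊓ p_u, whence the source index of v is p_g ⊓ (index of u), which
-- is precisely the condition for g to be an arrow of Δ̂₊.  Faithfulness is
-- immediate since R is the identity on underlying maps.

open import Defs
open import Data.Nat using (ℕ)
open import Data.Fin using (zero)
open import Data.Product using (_×_; proj₁)
open import Relation.Binary.PropositionalEquality using (_≡_)

open import Data.Nat using (suc; _+_; _≤_; _<_; _⊓_; _<?_; _≟_; s≤s; s≤s⁻¹)
open import Data.Nat.Properties
open import Data.Fin using (Fin; toℕ; fromℕ<; inject)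
open import Data.Fin.Properties
  using (toℕ-injective; toℕ-fromℕ<; toℕ<n; toℕ-inject; all?; ¬∀⟶∃¬-smallest)
open import Data.Product using (Σ; _,_; proj₂)
open import Data.Sum using (inj₁; inj₂)
open import Data.Empty using (⊥; ⊥-elim)
open import Function using (_∘_)
open import Relation.Nullary using (Dec; yes; no)
open import Relation.Binary.PropositionalEquality
  using (refl; sym; trans; cong; subst; _≗_; module ≡-Reasoning)

pointAt : ∀ {k n} → n < suc k → Σ (Fin (suc k)) λ x → toℕ x ≡ n
pointAt lt = fromℕ< lt , toℕ-fromℕ< lt

idx≤ : ∀ {k} (i : Fin (suc (suc k))) → toℕ i ≤ suc k
idx≤ i = s≤s⁻¹ (toℕ<n i)

module Displacement {k m : ℕ} (f : Map k m) (sf : StrictInc f) where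

  spread : ∀ d (y x : Fin (suc k)) → toℕ y + d ≡ toℕ x → toℕ (f y) + d ≤ toℕ (f x)
  spread ℕ.zero y x y≡x rewrite +-identityʳ (toℕ y) | toℕ-injective y≡x =
    ≤-reflexive (+-identityʳ (toℕ (f x)))
  spread (suc d) y x y+1+d≡x = begin
    toℕ (f y) + suc d   ≡⟨ +-suc (toℕ (f y)) d ⟩
    suc (toℕ (f y) + d) ≤⟨ s≤s (spread d y z (sym z≡y+d)) ⟩
    suc (toℕ (f z))     ≤⟨ sf z x (subst (_< toℕ x) (sym z≡y+d) y+d<x) ⟩
    toℕ (f x)           ∎
    where
    open ≤-Reasoning
    y+d<x : toℕ y + d < toℕ x
    y+d<x = subst (toℕ y + d <_) y+1+d≡x (+-monoʳ-< (toℕ y) (n<1+n d))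
    z : Fin (suc k)
    z = proj₁ (pointAt (<-trans y+d<x (toℕ<n x)))
    z≡y+d : toℕ z ≡ toℕ y + d
    z≡y+d = proj₂ (pointAt (<-trans y+d<x (toℕ<n x)))

  inflationary : ∀ x → toℕ x ≤ toℕ (f x)
  inflationary x = ≤-trans (m≤n+m (toℕ x) (toℕ (f zero))) (spread (toℕ x) zero x refl)

  movedUpward : ∀ y x → toℕ y ≤ toℕ x → toℕ y < toℕ (f y) → toℕ x < toℕ (f x)
  movedUpward y x y≤x y<fy with m≤n⇒∃[o]m+o≡n y≤x
  ... | d , y+d≡x = begin-strict
    toℕ x           ≡⟨ sym y+d≡x ⟩
    toℕ y + d       <⟨ +-monoˡ-< d y<fy ⟩
    toℕ (f y) + d   ≤⟨ spread d y x y+d≡x ⟩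
    toℕ (f x)       ∎
    where open ≤-Reasoning

record IsThreshold {k m : ℕ} (f : Map k m) (p : ℕ) : Set where
  field
    bound : p ≤ suc k
    fixes : FixBelow p f
    moves : MovesFrom p f
open IsThreshold

Threshold : ∀ {k m} → Map k m → Set
Threshold f = Σ ℕ (IsThreshold f)

fixed-and-moved : ∀ {k m} {f : Map k m} {a b} →
                  FixBelow a f → MovesFrom b f → b < a → a ≤ suc k → ⊥
fixed-and-moved {a = a} fix mov b<a a≤1+k with pointAt (<-≤-trans b<a a≤1+k)
... | x , x≡b = <-irrefl (sym (fix x (subst (_< a) (sym x≡b) b<a)))
                         (mov x (≤-reflexive (sym x≡b)))

fixBelow⇒≤threshold : ∀ {k m} {f : Map k m} {p a} →
                      IsThreshold f p → FixBelow a f → a ≤ suc k → a ≤ p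
fixBelow⇒≤threshold th fix a≤1+k =
  ≮⇒≥ (λ p<a → fixed-and-moved fix (moves th) p<a a≤1+k)

movesFrom⇒threshold≤ : ∀ {k m} {f : Map k m} {p b} →
                       IsThreshold f p → MovesFrom b f → p ≤ b
movesFrom⇒threshold≤ th mov =
  ≮⇒≥ (λ b<p → fixed-and-moved (fixes th) mov b<p (bound th))

isFixed? : ∀ {k m} (f : Map k m) (x : Fin (suc k)) → Dec (toℕ (f x) ≡ toℕ x)
isFixed? f x = toℕ (f x) ≟ toℕ x

-- Every strictly increasing map has a threshold: the smallest moved
-- point, or k+1 if f is the inclusion.

threshold : ∀ {k m} (f : Map k m) → StrictInc f → Threshold f
threshold {k} f sf with all? (isFixed? f)
... | yes allFixed = suc k , record
  { bound = ≤-refl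
  ; fixes = λ x _ → allFixed x
  ; moves = λ x k+1≤x → ⊥-elim (≤⇒≯ k+1≤x (toℕ<n x))
  }
... | no notAllFixed with ¬∀⟶∃¬-smallest _ _ (isFixed? f) notAllFixed
...   | x , xMoved , earlierFixed = toℕ x , record
  { bound = <⇒≤ (toℕ<n x)
  ; fixes = fixesBelow
  ; moves = λ y x≤y → movedUpward x y x≤y (≤∧≢⇒< (inflationary x) (xMoved ∘ sym))
  }
  where
  open Displacement f sf
  fixesBelow : FixBelow (toℕ x) f
  fixesBelow y y<x = subst (λ z → toℕ (f z) ≡ toℕ z) (toℕ-injective same) (earlierFixed j)
    where
    j = fromℕ< y<x
    same : toℕ (inject j) ≡ toℕ y
    same = trans (toℕ-inject j) (toℕ-fromℕ< y<x)

IsThreshold-resp : ∀ {k m} {f g : Map k m} {p} → f ≗ g → IsThreshold f p → IsThreshold g p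
IsThreshold-resp f≗g th = record
  { bound = bound th
  ; fixes = λ x x<p → trans (cong toℕ (sym (f≗g x))) (fixes th x x<p)
  ; moves = λ x p≤x → subst (toℕ x <_) (cong toℕ (f≗g x)) (moves th x p≤x)
  }

-- A composite fixes x iff both factors fix it (each factor is
-- inflationary), so its threshold is the smaller of the two.
threshold-∘ : ∀ {l k m} {g : Map l k} {u : Map k m} {p q} →
              StrictInc g → StrictInc u →
              IsThreshold g p → IsThreshold u q → IsThreshold (u ∘ g) (p ⊓ q)
threshold-∘ {g = g} {u} {p} {q} sg su thg thu = record
  { bound = ≤-trans (m⊓n≤m p q) (bound thg)
  ; fixes = fixesBelow
  ; moves = movesFrom
  }
  where
  fixesBelow : FixBelow (p ⊓ q) (u ∘ g)
  fixesBelow x x<p⊓q = trans (fixes thu (g x) gx<q) gx≡x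
    where
    gx≡x = fixes thg x (<-≤-trans x<p⊓q (m⊓n≤m p q))
    gx<q = subst (_< q) (sym gx≡x) (<-≤-trans x<p⊓q (m⊓n≤n p q))
  movesFrom : MovesFrom (p ⊓ q) (u ∘ g)
  movesFrom x p⊓q≤x with ≤-total p q
  ... | inj₁ p≤q = <-≤-trans (moves thg x (subst (_≤ toℕ x) (m≤n⇒m⊓n≡m p≤q) p⊓q≤x))
                             (Displacement.inflationary u su (g x))
  ... | inj₂ q≤p = ≤-<-trans (Displacement.inflationary g sg x)
                             (moves thu (g x) q≤gx)
    where
    q≤gx = ≤-trans (subst (_≤ toℕ x) (m≥n⇒m⊓n≡n q≤p) p⊓q≤x)
                   (Displacement.inflationary g sg x)

Cond⇒index : ∀ {k m} {f : Map k m} {p i j} →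
             IsThreshold f p → i ≤ suc k → Condˆ i j f → i ≡ p ⊓ j
Cond⇒index {p = p} {j = j} th i≤1+k (inj₁ (i<j , fix , mov)) =
  trans i≡p (sym (m≤n⇒m⊓n≡m (subst (_≤ j) i≡p (<⇒≤ i<j))))
  where
  i≡p = ≤-antisym (fixBelow⇒≤threshold th fix i≤1+k) (movesFrom⇒threshold≤ th mov)
Cond⇒index th i≤1+k (inj₂ (refl , fix)) =
  sym (m≥n⇒m⊓n≡n (fixBelow⇒≤threshold th fix i≤1+k))

index⇒Cond : ∀ {k m} {f : Map k m} {p} → IsThreshold f p → ∀ j → Condˆ (p ⊓ j) j f
index⇒Cond {p = p} th j with p <? j
... | yes p<j rewrite m≤n⇒m⊓n≡m (<⇒≤ p<j) = inj₁ (p<j , fixes th , moves th)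
... | no p≮j rewrite m≥n⇒m⊓n≡n (≮⇒≥ p≮j) =
  inj₂ (refl , λ x x<j → fixes th x (<-≤-trans x<j (≮⇒≥ p≮j)))

liftSource : ∀ {k m} (f : HomΔ k m) (j : Fin (suc (suc m))) →
             Σ (Fin (suc (suc k))) λ i → Condˆ (toℕ i) (toℕ j) (proj₁ f)
liftSource (f , sf) j with threshold f sf
... | p , th with pointAt (s≤s (≤-trans (m⊓n≤m p (toℕ j)) (bound th)))
...   | i , i≡p⊓j = i , subst (λ t → Condˆ t (toℕ j) f) (sym i≡p⊓j) (index⇒Cond th (toℕ j))

objSurj : ∀ (A : Objˆ) (Q : CoSliceΔObj (R₀ A)) → Σ (CoSliceˆObj A) λ P → R/₀ P ≈Δo Q
objSurj (m ⟨ j ⟩) (k , (u , su)) with liftSource (u , su) j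
... | i , cond = ((k ⟨ i ⟩) , (u , su , cond)) , refl , λ _ → refl

objInj : ∀ (A : Objˆ) (P P' : CoSliceˆObj A) → R/₀ P ≈Δo R/₀ P' → P ≈ˆo P'
objInj (m ⟨ j ⟩) ((k ⟨ i ⟩) , (u , su , cu)) ((.k ⟨ i' ⟩) , (v , sv , cv)) (refl , u≗v)
  with threshold u su
... | p , th = refl , toℕ-injective i≡i' , u≗v
  where
  open ≡-Reasoning
  i≡i' : toℕ i ≡ toℕ i'
  i≡i' = begin
    toℕ i       ≡⟨ Cond⇒index th (idx≤ i) cu ⟩
    p ⊓ toℕ j   ≡⟨ sym (Cond⇒index (IsThreshold-resp u≗v th) (idx≤ i') cv) ⟩
    toℕ i'      ∎

-- If u ∘ g ≗ v then the source index of v is (threshold of g) ⊓ (source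
-- index of u), which is exactly the condition making g an arrow of Δ̂₊.
full : ∀ (A : Objˆ) (P Q : CoSliceˆObj A) (g : CoSliceΔHom (R/₀ P) (R/₀ Q)) →
       Σ (CoSliceˆHom P Q) λ h → _≈Δh_ {P = R/₀ P} {Q = R/₀ Q} (R/₁ {P = P} {Q = Q} h) g
full (m ⟨ j ⟩) ((k ⟨ i ⟩) , (u , su , cu)) ((l ⟨ i' ⟩) , (v , sv , cv)) ((g , sg) , ug≗v)
  with threshold u su | threshold g sg
... | q , thu | p , thg = ((g , sg , condg) , ug≗v) , λ _ → refl
  where
  open ≡-Reasoning
  thv : IsThreshold v (p ⊓ q)
  thv = IsThreshold-resp ug≗v (threshold-∘ sg su thg thu)
  i'≡p⊓i : toℕ i' ≡ p ⊓ toℕ i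
  i'≡p⊓i = begin
    toℕ i'              ≡⟨ Cond⇒index thv (idx≤ i') cv ⟩
    p ⊓ q ⊓ toℕ j       ≡⟨ ⊓-assoc p q (toℕ j) ⟩
    p ⊓ (q ⊓ toℕ j)     ≡⟨ cong (p ⊓_) (sym (Cond⇒index thu (idx≤ i) cu)) ⟩
    p ⊓ toℕ i           ∎
  condg : Condˆ (toℕ i') (toℕ i) g
  condg = subst (λ t → Condˆ t (toℕ i) g) (sym i'≡p⊓i) (index⇒Cond thg (toℕ i))

-- Every Δ₊ arrow satisfies Condˆ 0 0 (so [m] ↦ [m]_0 is a full embedding),
-- R retracts it, and R/ is bijective on objects, full, and faithful — the
-- last because R/₁ does not change underlying maps.
lemma8p2 : ((k m : ℕ) (f : HomΔ k m) → Condˆ 0 0 (proj₁ f))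
           × ((m : ℕ) → R₀ (ι₀ m) ≡ m)
           × ((A : Objˆ) → IsIsoR/ A)
lemma8p2 =
  (λ k m f → inj₂ (refl , λ x ())) ,
  (λ m → refl) ,
  (λ A → objSurj A , objInj A , full A , λ P Q h h' same → same)
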